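{- Let $\mathcal{W}$ be a bounded lattice of truth values, $PR$ a many-valued logic program with predicate set $P$ and many-valued Herbrand model $I_{mv}$. Let $\mathcal{M}_I$ be the Kripke model of the unary-modal transformation $P_{mm}$ and $\mathcal{M}$ the Kripke-style model of the ontological encapsulation $PR_F$ (both described in the context). Then for every atom $p(x_1,\dots,x_n)$ of $PR$, every assignment $g$ and every $w\in\mathcal{W}$: $\mathcal{M}\models_{w,g}\mathcal{E}(p(x_1,\dots,x_n))$ iff $[w]p(g(x_1),\dots,g(x_n))$ is true in $\mathcal{M}_I$.
   Context: $\mathcal{M}_I=(\mathcal{W},\{\mathcal{R}_w:w\in\mathcal{W}\},S,V_I)$ with worlds $\mathcal{W}$, $\mathcal{R}_w=\mathcal{W}\times\{w\}$, $V_I(w,p)(\mathbf{c})=1$ iff $w=I_{mv}(p(\mathbf{c}))$; $\mathcal{M}_I\models_{w}p(\mathbf{c})$ iff $V_I(w,p)(\mathbf{c})=1$; the unary modal operator $[\alpha]$ is interpreted by $\mathcal{M}_I\models_w[\alpha]p(\mathbf{c})$ iff $\mathcal{M}_I\models_y p(\mathbf{c})$ for all $y$ with $(w,y)\in\mathcal{R}_\alpha$; a formula is true in $\mathcal{M}_I$ if satisfied at every world. For each $p\in P$ of arity $n$, $\kappa_p$ is the function with $\kappa_p(\mathbf{c})=I_{mv}(p(\mathbf{c}))$, and $p_F$ is a new predicate of arity $n+1$; $\mathcal{E}(p(x_1,\dots,x_n))=p_F(x_1,\dots,x_n,\kappa_p(x_1,\dots,x_n))$. $\mathcal{M}$ has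 worlds $\mathcal{W}$ and valuation $V(w,p_F)(c_1,\dots,c_n,\alpha)=1$ iff $w=\alpha=\kappa_p(c_1,\dots,c_n)$, with $\mathcal{M}\models_{w,g}p_F(x_1,\dots,x_n,t)$ iff $V(w,p_F)(g(x_1),\dots,g(x_n),t/g)=1$. -}

module Defs where

open import Level using (Level; _⊔_) renaming (suc to lsuc; zero to lzero)
open import Data.Nat using (ℕ)
open import Data.Vec using (Vec; map)
open import Data.Product using (_×_)
open import Relation.Binary.Lattice.Bundles using (BoundedLattice)

record MVProgram {c ℓ₁ ℓ₂ : Level} (W : BoundedLattice c ℓ₁ ℓ₂) : Set (lsuc lzero ⊔ c) where
  open BoundedLattice W
  field
    Pred  : Set
    arity : Pred → ℕ
    Const : Set
    Var   : Set
    Imv   : (p : Pred) → Vec Const (arity p) → Carrier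

module _ {c ℓ₁ ℓ₂ : Level} {W : BoundedLattice c ℓ₁ ℓ₂} (PR : MVProgram W) where
  open BoundedLattice W
  open MVProgram PR

  -- Accessibility: R_w = W × {w}, i.e. (u , y) ∈ R_w iff y = w.
  R : Carrier → Carrier → Carrier → Set ℓ₁
  R w u y = y ≈ w

  V-I : Carrier → (p : Pred) → Vec Const (arity p) → Set ℓ₁
  V-I w p cs = w ≈ Imv p cs

  data MFormula : Set c where
    atom : (p : Pred) → Vec Const (arity p) → MFormula
    box  : Carrier → MFormula → MFormula

  satI : Carrier → MFormula → Set (c ⊔ ℓ₁)
  satI w (atom p cs) = Level.Lift c (V-I w p cs)
  satI w (box α φ)   = (y : Carrier) → R α w y → satI y φ

  trueI : MFormula → Set (c ⊔ ℓ₁)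
  trueI φ = (w : Carrier) → satI w φ

  Assignment : Set
  Assignment = Var → Const

  data KTerm : Set where
    kappa : (p : Pred) → Vec Var (arity p) → KTerm

  κ : (p : Pred) → Vec Const (arity p) → Carrier
  κ p cs = Imv p cs

  evalK : KTerm → Assignment → Carrier
  evalK (kappa p xs) g = κ p (map g xs)

  data Atom : Set where
    patom : (p : Pred) → Vec Var (arity p) → Atom

  data FAtom : Set where
    pF : (p : Pred) → Vec Var (arity p) → KTerm → FAtom

  E : Atom → FAtom
  E (patom p xs) = pF p xs (kappa p xs)

  V : Carrier → (p : Pred) → Vec Const (arity p) → Carrier → Set ℓ₁
  V w p cs α = (w ≈ α) × (α ≈ κ p cs)

  satM : Carrier → Assignment → FAtom → Set ℓ₁
  satM w g (pF p xs t) = V w p (map g xs) (evalK t g)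

module Submission where

-- Both sides of Theorem 4 say the same thing: the world w is the truth value
-- I_mv(p(c)) of the ground atom p(c), where c = g(x_1),…,g(x_n).
--
--  * In the Kripke model M_I the accessibility relation R_α = W × {α} sends
--    every world to α and to nothing else.  Hence satisfaction of a formula
--    is invariant under ≈ of worlds (satI-resp-≈), and a boxed formula [α]φ
--    is true in M_I exactly when φ holds at the single world α
--    (box-true⇔sat).  For an atom this is the valuation V_I(α,p)(c).
--  * In the encapsulation model M, the term κ_p(x) evaluates under g to
--    κ_p(c) = I_mv(p(c)), so V(w,p_F)(c, κ_p(c)) reduces to w ≈ I_mv(p(c))
--    (satM-E⇔).
--
-- The theorem is the composition of these two characterisations.

open import Defs
open import Level using (Level; lift; lower)
open import Data.Vec using (Vec; map)
open import Data.Product using (_,_; proj₁)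
open import Function.Bundles using (_⇔_; mk⇔)
import Function.Properties.Equivalence as ⇔
open import Relation.Binary.Lattice.Bundles using (BoundedLattice)

module _ {c ℓ₁ ℓ₂ : Level} {W : BoundedLattice c ℓ₁ ℓ₂} (PR : MVProgram W) where
  open BoundedLattice W using (Carrier; _≈_; module Eq)
  open MVProgram PR using (Pred; arity; Const; Var; Imv)

  -- Satisfaction in M_I respects equality of worlds.  For [α]φ this holds
  -- because the worlds accessible via R_α do not depend on the current world.
  satI-resp-≈ : (φ : MFormula PR) {u v : Carrier} → u ≈ v → satI PR u φ → satI PR v φ
  satI-resp-≈ (atom p cs) u≈v (lift u≈I) = lift (Eq.trans (Eq.sym u≈v) u≈I)
  satI-resp-≈ (box α φ)   u≈v h          = h

  -- [α]φ is true in M_I (at every world) iff φ is satisfied at the world α,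
  -- since α is, up to ≈, the unique R_α-successor of every world.
  box-true⇔sat : (α : Carrier) (φ : MFormula PR) → trueI PR (box α φ) ⇔ satI PR α φ
  box-true⇔sat α φ = mk⇔
    (λ h → h α α Eq.refl)
    (λ h _ y y≈α → satI-resp-≈ φ (Eq.sym y≈α) h)

  atom-sat⇔ : (w : Carrier) (p : Pred) (cs : Vec Const (arity p)) →
              satI PR w (atom p cs) ⇔ (w ≈ Imv p cs)
  atom-sat⇔ w p cs = mk⇔ lower lift

  -- The encapsulated atom E(p(x)) = p_F(x, κ_p(x)) holds at (w, g) in M iff w
  -- is the truth value of p(g(x)): the second condition α = κ_p(g(x)) of the
  -- valuation is automatic because α is itself κ_p(g(x)).
  satM-E⇔ : (w : Carrier) (g : Assignment PR) (p : Pred) (xs : Vec Var (arity p)) →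
            satM PR w g (E PR (patom p xs)) ⇔ (w ≈ Imv p (map g xs))
  satM-E⇔ w g p xs = mk⇔ proj₁ (λ w≈I → w≈I , Eq.refl)

mainTheorem4 : {c ℓ₁ ℓ₂ : Level} {W : BoundedLattice c ℓ₁ ℓ₂} (PR : MVProgram W)
    (p : MVProgram.Pred PR) (xs : Vec (MVProgram.Var PR) (MVProgram.arity PR p))
    (g : Assignment PR) (w : BoundedLattice.Carrier W) →
    satM PR w g (E PR (patom p xs)) ⇔ trueI PR (box w (atom p (map g xs)))
mainTheorem4 PR p xs g w =
  ⇔.trans (satM-E⇔ PR w g p xs)
  (⇔.sym (⇔.trans (box-true⇔sat PR w (atom p (map g xs)))
                   (atom-sat⇔ PR w p (map g xs))))
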